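{- For a chain $C$, neither $(\omega^*+\omega)\cdot\omega$ nor $(\omega^*+\omega)\cdot\omega^*$ embeds into $C$ if and only if $C$ is a finite sum of surordinals and reverses of surordinals.
   Context: A chain is a linearly ordered set; an embedding is an injective map $f$ with $x<y\iff f(x)<f(y)$. $\omega^*$ is the reverse of $\omega$; $A\cdot B$ denotes the ordered sum of $B$ copies of $A$ (lexicographically, with $B$ as outer index). A chain $S$ is a surordinal if for each $x\in S$ the final segment $\{y\in S:y\geq x\}$ is well ordered (equivalently, $1+\omega^*$ does not embed into $S$); a reverse surordinal is the reverse of a surordinal. A finite sum $A_0+\cdots+A_{n-1}$ places all elements of $A_i$ before those of $A_j$ for $i<j$. -}

module Defs where

open import Level using (0ℓ)
open import Data.Nat as ℕ using (ℕ; zero; suc)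
open import Data.Integer as ℤ using (ℤ)
open import Data.Fin as Fin using (Fin)
open import Data.Product using (Σ; ∃; _×_; _,_; proj₁)
open import Data.Sum using (_⊎_)
open import Function using (flip)
open import Function.Bundles using (_⇔_)
open import Function.Definitions using (Injective)
open import Relation.Binary.PropositionalEquality using (_≡_)
open import Relation.Binary.Structures using (IsStrictTotalOrder)
open import Induction.WellFounded using (WellFounded)

record OrderedSet : Set₁ where
  field
    Carrier : Set
    _<_     : Carrier → Carrier → Set

record Chain : Set₁ where
  field
    ordered : OrderedSet
  open OrderedSet ordered public
  field
    isStrictTotalOrder : IsStrictTotalOrder _≡_ _<_

record Embedding (A B : OrderedSet) : Set where
  open OrderedSet A renaming (Carrier to |A|; _<_ to _<A_)
  open OrderedSet B renaming (Carrier to |B|; _<_ to _<B_)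
  field
    map       : |A| → |B|
    injective : Injective _≡_ _≡_ map
    order     : ∀ x y → (x <A y) ⇔ (map x <B map y)

_↪_ : OrderedSet → OrderedSet → Set
A ↪ B = Embedding A B

reverse : OrderedSet → OrderedSet
reverse A = record { Carrier = OrderedSet.Carrier A ; _<_ = flip (OrderedSet._<_ A) }

sub : (A : OrderedSet) → (OrderedSet.Carrier A → Set) → OrderedSet
sub A P = record
  { Carrier = Σ (OrderedSet.Carrier A) P
  ; _<_     = λ u v → OrderedSet._<_ A (proj₁ u) (proj₁ v) }

Le : (A : OrderedSet) → OrderedSet.Carrier A → OrderedSet.Carrier A → Set
Le A x y = OrderedSet._<_ A x y ⊎ x ≡ y

-- Well ordered (for a linearly ordered set): the order is well founded.
WellOrdered : OrderedSet → Set
WellOrdered A = WellFounded (OrderedSet._<_ A)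

finalSegment : (A : OrderedSet) → OrderedSet.Carrier A → OrderedSet
finalSegment A x = sub A (λ y → Le A x y)

Surordinal : OrderedSet → Set
Surordinal A = ∀ x → WellOrdered (finalSegment A x)

ReverseSurordinal : OrderedSet → Set
ReverseSurordinal A = Surordinal (reverse A)

-- C is a finite sum A_0 + ... + A_{n-1} of surordinals and reverse
-- surordinals: C is partitioned by a monotone map into Fin n (block i =
-- A_i, all elements of A_i before those of A_j for i < j), each block
-- (with the induced order) a surordinal or a reverse surordinal.
FiniteSumOfSurordinals : Chain → Set
FiniteSumOfSurordinals C =
  Σ ℕ λ n → Σ (Chain.Carrier C → Fin n) λ p →
    (∀ x y → Chain._<_ C x y → p x Fin.≤ p y) ×
    (∀ (i : Fin n) →
       let B = sub (Chain.ordered C) (λ x → p x ≡ i)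
       in Surordinal B ⊎ ReverseSurordinal B)

ω*+ω : OrderedSet
ω*+ω = record { Carrier = ℤ ; _<_ = ℤ._<_ }

-- (ω*+ω)·ω : ω copies of ω*+ω, lexicographic with the ℕ-index outer.
[ω*+ω]·ω : OrderedSet
[ω*+ω]·ω = record
  { Carrier = ℤ × ℕ
  ; _<_ = λ { (a , m) (b , n) → m ℕ.< n ⊎ (m ≡ n × a ℤ.< b) } }

-- (ω*+ω)·ω* : ω* copies of ω*+ω (outer index ordered reversely).
[ω*+ω]·ω* : OrderedSet
[ω*+ω]·ω* = record
  { Carrier = ℤ × ℕ
  ; _<_ = λ { (a , m) (b , n) → n ℕ.< m ⊎ (m ≡ n × a ℤ.< b) } }

-- Dependent choice (part of the ambient ZFC of the paper).
DependentChoice : Set₁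
DependentChoice = (A : Set) (R : A → A → Set) → (∀ a → ∃ λ b → R a b) →
  (a₀ : A) → Σ (ℕ → A) λ f → f zero ≡ a₀ × (∀ n → R (f n) (f (suc n)))

-- Gluing the ω*-half of one copy of ω+ω* to the ω-half of the next turns a sequence of copies
-- of ω+ω*, each above (below) the previous one, into a copy of (ω*+ω)·ω ((ω*+ω)·ω*), and
-- conversely. Both sides are compared with layerings: monotone maps C → Fin n none of whose
-- layers contains a copy of ω+ω*. The blocks of a finite sum of surordinals and reverse
-- surordinals form a layering (the ω*-half of a copy would descend in a surordinal block, its
-- ω-half ascend in a reverse one), and conversely every layer splits into the points having an
-- increasing sequence of their layer below them, a surordinal, preceded by the others, a reverse
-- surordinal. Along a ladder of copies the layers strictly increase (decrease), so a layering
-- excludes both embeddings. Finally, if the number of copies that can be stacked in C is bounded,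
-- the number stacked below x is a layering; otherwise dependent choice yields a ladder: it climbs
-- as long as every lower bound with unboundedly many copies above it is followed by a copy with
-- unboundedly many copies above it, and otherwise it descends below such a lower bound.

module Submission where

open import Defs
open import Axiom.ExcludedMiddle using (ExcludedMiddle)
open import Axiom.DoubleNegationElimination using (em⇒dne)
open import Level using (0ℓ)
open import Data.Nat as ℕ using (ℕ; zero; suc; _+_; z≤n; s≤s)
import Data.Nat.Properties as ℕ
open import Data.Integer as ℤ using (ℤ; +_; -[1+_]; +<+; -<-; -<+)
import Data.Integer.Properties as ℤ
open import Data.Fin as Fin using (Fin; toℕ; fromℕ<; combine)
import Data.Fin.Properties as Fin
import Data.Fin.Induction as Fin
open import Data.Fin.Patterns using (0F; 1F)
open import Data.Maybe using (Maybe; just; nothing)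
open import Data.Product using (Σ; ∃; _×_; _,_; proj₁; proj₂)
open import Data.Sum using (_⊎_; inj₁; inj₂; fromInj₂)
import Data.Sum as Sum
open import Data.Empty using (⊥-elim)
open import Data.Unit using (⊤; tt)
open import Function.Base using (_∘_)
open import Function.Bundles using (_⇔_; mk⇔; Equivalence)
open import Relation.Nullary using (¬_; Dec; yes; no)
open import Relation.Binary.Definitions using (Transitive; Trichotomous; Tri; tri<; tri≈; tri>)
open import Data.Product.Relation.Binary.Lex.Strict using (×-compare)
import Relation.Binary.Construct.Flip.EqAndOrd as Flip
open import Relation.Binary.PropositionalEquality
  using (_≡_; _≢_; refl; sym; trans; cong; subst; subst₂)
open import Relation.Binary.Structures using (IsStrictTotalOrder)
open import Induction.WellFounded using (WellFounded; Acc; acc)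
open import Induction.InfiniteDescent using (InfiniteDescendingSequence)

descending⇒¬acc : ∀ {A : Set} {R : A → A → Set} (f : ℕ → A) →
                  InfiniteDescendingSequence R f → ¬ Acc R (f 0)
descending⇒¬acc f desc (acc rs) = descending⇒¬acc (f ∘ suc) (desc ∘ suc) (rs (desc 0))

increasing⇒monotone : ∀ {A : Set} {R : A → A → Set} → Transitive R → (f : ℕ → A) →
                      (∀ i → R (f i) (f (suc i))) → ∀ {i j} → i ℕ.< j → R (f i) (f j)
increasing⇒monotone {R = R} tr f inc {i} {suc j} (s≤s i≤j) with ℕ.m≤n⇒m<n∨m≡n i≤j
... | inj₁ i<j  = tr (increasing⇒monotone {R = R} tr f inc i<j) (inc j)
... | inj₂ refl = inc j

maximum : (P : ℕ → Set) → (∀ n → Dec (P n)) → P 0 →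
          ∀ N → (∀ j → P j → j ℕ.< N) → ∃ λ m → P m × (∀ j → P j → j ℕ.≤ m)
maximum P P? p₀ zero    bound = ⊥-elim (ℕ.n≮0 (bound 0 p₀))
maximum P P? p₀ (suc N) bound with P? N
... | yes pN = N , pN , λ j pj → ℕ.s≤s⁻¹ (bound j pj)
... | no ¬pN = maximum P P? p₀ N λ j pj →
                 ℕ.≤∧≢⇒< (ℕ.s≤s⁻¹ (bound j pj)) λ { refl → ¬pN pj }

combine-monoʳ-≤ : ∀ {m n} (i : Fin m) {k l : Fin n} → k Fin.≤ l → combine i k Fin.≤ combine i l
combine-monoʳ-≤ {n = n} i {k} {l} k≤l =
  subst₂ ℕ._≤_ (sym (Fin.toℕ-combine i k)) (sym (Fin.toℕ-combine i l))
         (ℕ.+-monoʳ-≤ (n ℕ.* toℕ i) k≤l)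

¬∀⇒∃¬ : ExcludedMiddle 0ℓ → {A : Set} {P : A → Set} → ¬ (∀ x → P x) → ∃ λ x → ¬ P x
¬∀⇒∃¬ em ¬∀ = em⇒dne em λ ¬∃ → ¬∀ λ x → em⇒dne em λ ¬Px → ¬∃ (x , ¬Px)

chooseSequence : DependentChoice → {A : Set} (R : A → A → Set) → (∀ a → ∃ (R a)) → A →
                 Σ (ℕ → A) λ f → ∀ n → R (f n) (f (suc n))
chooseSequence dc R next a₀ = let (f , _ , steps) = dc _ R next a₀ in f , steps

noDescent⇒wellFounded : ExcludedMiddle 0ℓ → DependentChoice → {A : Set} (R : A → A → Set) →
                        (∀ f → ¬ InfiniteDescendingSequence R f) → WellFounded R
noDescent⇒wellFounded em dc {A} R noDescent x =
  dne λ ¬acc → let (f , desc) = chooseSequence dc (λ s t → R (proj₁ t) (proj₁ s)) below (x , ¬acc)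
               in noDescent (proj₁ ∘ f) desc
  where
  dne : {P : Set} → ¬ ¬ P → P
  dne = em⇒dne em
  Inaccessible : Set
  Inaccessible = Σ A λ z → ¬ Acc R z
  below : (s : Inaccessible) → ∃ λ (t : Inaccessible) → R (proj₁ t) (proj₁ s)
  below (z , ¬acc) = dne λ none → ¬acc (acc λ {y} y<z → dne λ ¬acc-y → none ((y , ¬acc-y) , y<z))

module _ (A : OrderedSet) (P : OrderedSet.Carrier A → Set) where
  open OrderedSet A

  NoDescentAbove : Set
  NoDescentAbove = ∀ x → P x → (s : ℕ → Carrier) → (∀ k → P (s k)) →
                   (∀ k → x < s k) → ¬ InfiniteDescendingSequence _<_ s

  surordinal⇒noDescentAbove : Surordinal (sub A P) → NoDescentAbove
  surordinal⇒noDescentAbove sur x px s Ps x<s desc =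
    descending⇒¬acc (λ k → (s k , Ps k) , inj₁ (x<s k)) desc (sur (x , px) _)

  noDescentAbove⇒surordinal : ExcludedMiddle 0ℓ → DependentChoice → Transitive _<_ →
                              NoDescentAbove → Surordinal (sub A P)
  noDescentAbove⇒surordinal em dc <-trans noDescent (x , px) =
    -- the final segment starts at x, so after dropping its first term the sequence lies strictly above x
    noDescent⇒wellFounded em dc _ λ s desc →
      noDescent x px (point ∘ s ∘ suc) (proj₂ ∘ proj₁ ∘ s ∘ suc)
                (λ k → ≤-<-trans (proj₂ (s (suc (suc k)))) (desc (suc k))) (desc ∘ suc)
    where
    point : Σ (Σ Carrier P) (Le (sub A P) (x , px)) → Carrier
    point = proj₁ ∘ proj₁
    ≤-<-trans : ∀ {y z} → Le (sub A P) (x , px) y → proj₁ y < z → x < z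
    ≤-<-trans (inj₁ x<y) y<z = <-trans x<y y<z
    ≤-<-trans (inj₂ refl) y<z = y<z

strictlyMonotone⇒embedding : (A B : OrderedSet) → let open OrderedSet in
  Trichotomous _≡_ (_<_ A) → (∀ {x} → ¬ _<_ B x x) → Transitive (_<_ B) →
  (f : Carrier A → Carrier B) → (∀ {x y} → _<_ A x y → _<_ B (f x) (f y)) → A ↪ B
strictlyMonotone⇒embedding A B cmp irrefl <-trans f mono = record
  { map = f ; injective = injective ; order = λ x y → mk⇔ mono (reflect x y) }
  where
  open OrderedSet
  reflect : ∀ x y → _<_ B (f x) (f y) → _<_ A x y
  reflect x y fx<fy with cmp x y
  ... | tri< x<y _ _ = x<y
  ... | tri≈ _ refl _ = ⊥-elim (irrefl fx<fy)
  ... | tri> _ _ y<x = ⊥-elim (irrefl (<-trans fx<fy (mono y<x)))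
  injective : ∀ {x y} → f x ≡ f y → x ≡ y
  injective {x} {y} fx≡fy with cmp x y
  ... | tri< x<y _ _ = ⊥-elim (irrefl (subst (λ z → _<_ B (f x) z) (sym fx≡fy) (mono x<y)))
  ... | tri≈ _ x≡y _ = x≡y
  ... | tri> _ _ y<x = ⊥-elim (irrefl (subst (λ z → _<_ B (f y) z) fx≡fy (mono y<x)))

Tri-resp-≈ : ∀ {A P Q B : Set} → (P → Q) → (Q → P) → Tri A P B → Tri A Q B
Tri-resp-≈ to from (tri< a ¬p ¬b) = tri< a (¬p ∘ from) ¬b
Tri-resp-≈ to from (tri≈ ¬a p ¬b) = tri≈ ¬a (to p) ¬b
Tri-resp-≈ to from (tri> ¬a ¬p b) = tri> ¬a (¬p ∘ from) b

outerLex-compare : {_⊏_ : ℕ → ℕ → Set} → Trichotomous _≡_ _⊏_ → ∀ (x y : ℤ × ℕ) →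
  let (a , m) = x ; (b , n) = y in
  Tri (m ⊏ n ⊎ (m ≡ n × a ℤ.< b)) (x ≡ y) (n ⊏ m ⊎ (n ≡ m × b ℤ.< a))
outerLex-compare cmp (a , m) (b , n) =
  Tri-resp-≈ (λ { (refl , refl) → refl }) (λ { refl → refl , refl })
             (×-compare sym cmp ℤ.<-cmp (m , a) (n , b))

module OnChain (C : Chain) where
  open Chain C renaming (Carrier to X)
  open IsStrictTotalOrder isStrictTotalOrder using (compare) renaming (trans to <-trans; irrefl to <-irrefl)

  _≤_ : X → X → Set
  _≤_ = Le ordered

  <-≤-trans : ∀ {x y z} → x < y → y ≤ z → x < z
  <-≤-trans x<y (inj₁ y<z) = <-trans x<y y<z
  <-≤-trans x<y (inj₂ refl) = x<y

  ≤-<-trans : ∀ {x y z} → x ≤ y → y < z → x < z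
  ≤-<-trans (inj₁ x<y) y<z = <-trans x<y y<z
  ≤-<-trans (inj₂ refl) y<z = y<z

  <-or-≥ : ∀ x y → x < y ⊎ y ≤ x
  <-or-≥ x y with compare x y
  ... | tri< x<y _ _ = inj₁ x<y
  ... | tri≈ _ x≡y _ = inj₂ (inj₂ (sym x≡y))
  ... | tri> _ _ y<x = inj₂ (inj₁ y<x)

  record Copyω+ω* : Set where
    field
      asc             : ℕ → X
      desc            : ℕ → X
      asc-increasing  : ∀ i → asc i < asc (suc i)
      desc-decreasing : InfiniteDescendingSequence _<_ desc
      asc<desc        : ∀ i j → asc i < desc j

    bottom top : X
    bottom = asc 0
    top    = desc 0

    asc-monotone : ∀ {i j} → i ℕ.< j → asc i < asc j
    asc-monotone = increasing⇒monotone {R = _<_} <-trans asc asc-increasing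

    desc-monotone : ∀ {i j} → i ℕ.< j → desc j < desc i
    desc-monotone = increasing⇒monotone {R = λ x y → y < x} (λ p q → <-trans q p) desc desc-decreasing

    bottom<top : bottom < top
    bottom<top = asc<desc 0 0

    bottom≤asc : ∀ i → bottom ≤ asc i
    bottom≤asc zero    = inj₂ refl
    bottom≤asc (suc i) = inj₁ (asc-monotone (s≤s z≤n))

    bottom≤desc : ∀ j → bottom ≤ desc j
    bottom≤desc j = inj₁ (asc<desc 0 j)

    asc≤top : ∀ i → asc i ≤ top
    asc≤top i = inj₁ (asc<desc i 0)

    desc≤top : ∀ j → desc j ≤ top
    desc≤top zero    = inj₂ refl
    desc≤top (suc j) = inj₁ (desc-monotone (s≤s z≤n))

    shift : Copyω+ω*
    shift = record
      { asc = asc ∘ suc ; desc = desc ∘ suc ; asc-increasing = asc-increasing ∘ suc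
      ; desc-decreasing = desc-decreasing ∘ suc ; asc<desc = λ i j → asc<desc (suc i) (suc j) }

  open Copyω+ω*

  AscendingLadder : Set
  AscendingLadder = Σ (ℕ → Copyω+ω*) λ G → ∀ m → top (G m) < bottom (G (suc m))

  DescendingLadder : Set
  DescendingLadder = Σ (ℕ → Copyω+ω*) λ G → ∀ m → top (G (suc m)) < bottom (G m)

  embedding⇒ascendingLadder : [ω*+ω]·ω ↪ ordered → AscendingLadder
  embedding⇒ascendingLadder E = G , λ m → map-< (inj₂ (refl , -<+))
    where
    open Embedding E
    map-< : ∀ {a b} → OrderedSet._<_ [ω*+ω]·ω a b → map a < map b
    map-< = Equivalence.to (order _ _)
    G : ℕ → Copyω+ω*
    G m = record
      { asc             = λ k → map (+ k , m)
      ; desc            = λ k → map (-[1+ k ] , suc m)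
      ; asc-increasing  = λ k → map-< (inj₂ (refl , +<+ (ℕ.n<1+n k)))
      ; desc-decreasing = λ k → map-< (inj₂ (refl , -<- (ℕ.n<1+n k)))
      ; asc<desc        = λ _ _ → map-< (inj₁ (ℕ.n<1+n m)) }

  embedding⇒descendingLadder : [ω*+ω]·ω* ↪ ordered → DescendingLadder
  embedding⇒descendingLadder E = G , λ m → map-< (inj₂ (refl , -<+))
    where
    open Embedding E
    map-< : ∀ {a b} → OrderedSet._<_ [ω*+ω]·ω* a b → map a < map b
    map-< = Equivalence.to (order _ _)
    G : ℕ → Copyω+ω*
    G m = record
      { asc             = λ k → map (+ k , suc m)
      ; desc            = λ k → map (-[1+ k ] , m)
      ; asc-increasing  = λ k → map-< (inj₂ (refl , +<+ (ℕ.n<1+n k)))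
      ; desc-decreasing = λ k → map-< (inj₂ (refl , -<- (ℕ.n<1+n k)))
      ; asc<desc        = λ _ _ → map-< (inj₁ (ℕ.n<1+n m)) }

  ascendingLadder⇒embedding : AscendingLadder → [ω*+ω]·ω ↪ ordered
  ascendingLadder⇒embedding (G , step) =
    strictlyMonotone⇒embedding [ω*+ω]·ω ordered (outerLex-compare ℕ.<-cmp)
                               (<-irrefl refl) <-trans point mono
    where
    point : ℤ × ℕ → X
    point (-[1+ k ] , m) = desc (G m) k
    point (+ k      , m) = asc (G (suc m)) k
    top<bottom : ∀ {m n} → m ℕ.< n → top (G m) < bottom (G n)
    top<bottom {m} {suc n} (s≤s m≤n) with ℕ.m≤n⇒m<n∨m≡n m≤n
    ... | inj₁ m<n  = <-trans (top<bottom m<n) (<-trans (bottom<top (G n)) (step n))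
    ... | inj₂ refl = step m
    across : ∀ {m n x y} → x ≤ top (G m) → m ℕ.< n → bottom (G n) ≤ y → x < y
    across x≤top m<n bottom≤y = ≤-<-trans x≤top (<-≤-trans (top<bottom m<n) bottom≤y)
    mono : ∀ {a b} → OrderedSet._<_ [ω*+ω]·ω a b → point a < point b
    mono { -[1+ k ] , m} { -[1+ l ] , n} (inj₁ m<n) = across (desc≤top (G m) k) m<n (bottom≤desc (G n) l)
    mono { -[1+ k ] , m} {+ l      , n} (inj₁ m<n) =
      across (desc≤top (G m) k) (ℕ.m<n⇒m<1+n m<n) (bottom≤asc (G (suc n)) l)
    mono {+ k      , m} { -[1+ l ] , n} (inj₁ m<n) with ℕ.m≤n⇒m<n∨m≡n m<n
    ... | inj₁ 1+m<n = across (asc≤top (G (suc m)) k) 1+m<n (bottom≤desc (G n) l)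
    ... | inj₂ refl  = asc<desc (G (suc m)) k l
    mono {+ k      , m} {+ l      , n} (inj₁ m<n) =
      across (asc≤top (G (suc m)) k) (s≤s m<n) (bottom≤asc (G (suc n)) l)
    mono { -[1+ k ] , m} { -[1+ l ] , m} (inj₂ (refl , -<- l<k)) = desc-monotone (G m) l<k
    mono { -[1+ k ] , m} {+ l      , m} (inj₂ (refl , -<+)) =
      across (desc≤top (G m) k) (ℕ.n<1+n m) (bottom≤asc (G (suc m)) l)
    mono {+ k      , m} {+ l      , m} (inj₂ (refl , +<+ k<l)) = asc-monotone (G (suc m)) k<l

  descendingLadder⇒embedding : DescendingLadder → [ω*+ω]·ω* ↪ ordered
  descendingLadder⇒embedding (G , step) =
    strictlyMonotone⇒embedding [ω*+ω]·ω* ordered (outerLex-compare (Flip.compare ℕ._<_ ℕ.<-cmp))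
                               (<-irrefl refl) <-trans point mono
    where
    point : ℤ × ℕ → X
    point (-[1+ k ] , m) = desc (G (suc m)) k
    point (+ k      , m) = asc (G m) k
    top<bottom : ∀ {m n} → m ℕ.< n → top (G n) < bottom (G m)
    top<bottom {m} {suc n} (s≤s m≤n) with ℕ.m≤n⇒m<n∨m≡n m≤n
    ... | inj₁ m<n  = <-trans (step n) (<-trans (bottom<top (G n)) (top<bottom m<n))
    ... | inj₂ refl = step m
    across : ∀ {m n x y} → x ≤ top (G n) → m ℕ.< n → bottom (G m) ≤ y → x < y
    across x≤top m<n bottom≤y = ≤-<-trans x≤top (<-≤-trans (top<bottom m<n) bottom≤y)
    mono : ∀ {a b} → OrderedSet._<_ [ω*+ω]·ω* a b → point a < point b
    mono { -[1+ k ] , m} { -[1+ l ] , n} (inj₁ n<m) =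
      across (desc≤top (G (suc m)) k) (s≤s n<m) (bottom≤desc (G (suc n)) l)
    mono { -[1+ k ] , m} {+ l      , n} (inj₁ n<m) =
      across (desc≤top (G (suc m)) k) (ℕ.m<n⇒m<1+n n<m) (bottom≤asc (G n) l)
    mono {+ k      , m} { -[1+ l ] , n} (inj₁ n<m) with ℕ.m≤n⇒m<n∨m≡n n<m
    ... | inj₁ 1+n<m = across (asc≤top (G m) k) 1+n<m (bottom≤desc (G (suc n)) l)
    ... | inj₂ refl  = asc<desc (G m) k l
    mono {+ k      , m} {+ l      , n} (inj₁ n<m) = across (asc≤top (G m) k) n<m (bottom≤asc (G n) l)
    mono { -[1+ k ] , m} { -[1+ l ] , m} (inj₂ (refl , -<- l<k)) = desc-monotone (G (suc m)) l<k
    mono { -[1+ k ] , m} {+ l      , m} (inj₂ (refl , -<+)) =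
      across (desc≤top (G (suc m)) k) (ℕ.n<1+n m) (bottom≤asc (G m) l)
    mono {+ k      , m} {+ l      , m} (inj₂ (refl , +<+ k<l)) = asc-monotone (G m) k<l

  module _ {n} {p : X → Fin n} (monotone : ∀ x y → x < y → p x Fin.≤ p y) where

    monotone-≤ : ∀ {x y} → x ≤ y → p x Fin.≤ p y
    monotone-≤ (inj₁ x<y) = monotone _ _ x<y
    monotone-≤ (inj₂ refl) = Fin.≤-refl

    monotone-convex : ∀ {x y z} → x ≤ z → z ≤ y → p x ≡ p y → p z ≡ p x
    monotone-convex x≤z z≤y px≡py =
      Fin.≤-antisym (subst (p _ Fin.≤_) (sym px≡py) (monotone-≤ z≤y)) (monotone-≤ x≤z)

  record Layering (n : ℕ) : Set where
    field
      layer           : X → Fin n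
      layer-monotone  : ∀ x y → x < y → layer x Fin.≤ layer y
      layer-separates : ∀ g → layer (bottom g) ≢ layer (top g)

    layer-bottom<top : ∀ g → layer (bottom g) Fin.< layer (top g)
    layer-bottom<top g = Fin.≤∧≢⇒< (layer-monotone _ _ (bottom<top g)) (layer-separates g)

    ¬ascendingLadder : ¬ AscendingLadder
    ¬ascendingLadder (G , step) =
      descending⇒¬acc {R = λ i j → j Fin.< i} (λ m → layer (bottom (G m)))
        (λ m → ℕ.<-≤-trans (layer-bottom<top (G m)) (layer-monotone _ _ (step m)))
        (Fin.>-wellFounded _)

    ¬descendingLadder : ¬ DescendingLadder
    ¬descendingLadder (G , step) =
      descending⇒¬acc (λ m → layer (bottom (G m)))
        (λ m → ℕ.<-≤-trans (layer-bottom<top (G (suc m))) (layer-monotone _ _ (step m)))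
        (Fin.<-wellFounded _)

  finiteSum⇒layering : FiniteSumOfSurordinals C → ∃ Layering
  finiteSum⇒layering (n , p , monotone , blocks) =
    n , record { layer = p ; layer-monotone = monotone ; layer-separates = separates }
    where
    separates : ∀ g → p (bottom g) ≢ p (top g)
    separates g eq with blocks (p (bottom g))
    ... | inj₁ surordinal = surordinal⇒noDescentAbove ordered _ surordinal (bottom g) refl
            (desc g) (λ k → monotone-convex monotone (bottom≤desc g k) (desc≤top g k) eq)
            (asc<desc g 0) (desc-decreasing g)
    ... | inj₂ reverseSurordinal = surordinal⇒noDescentAbove (reverse ordered) _ reverseSurordinal
            (top g) (sym eq) (asc g) (λ k → monotone-convex monotone (bottom≤asc g k) (asc≤top g k) eq)
            (λ k → asc<desc g k 0) (asc-increasing g)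

  -- nothing is the bound −∞ in Above and +∞ in Below
  Above : Maybe X → X → Set
  Above nothing  _ = ⊤
  Above (just a) x = a < x

  Below : X → Maybe X → Set
  Below _ nothing  = ⊤
  Below x (just b) = x < b

  below-trans : ∀ {x y b} → x < y → Below y b → Below x b
  below-trans {b = nothing} _ _ = tt
  below-trans {b = just _} x<y y<b = <-trans x<y y<b

  Stack : Maybe X → Maybe X → ℕ → Set
  Stack a b zero    = ⊤
  Stack a b (suc n) = Σ Copyω+ω* λ g → Above a (bottom g) × Below (top g) b × Stack (just (top g)) b n

  stack-truncate : ∀ {a b m n} → m ℕ.≤ n → Stack a b n → Stack a b m
  stack-truncate {m = zero}  _         _                     = tt
  stack-truncate {m = suc m} (s≤s m≤n) (g , a<g , g<b , rest) = g , a<g , g<b , stack-truncate m≤n rest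

  stack-lowerˡ : ∀ {a a' b n} → (∀ {x} → Above a x → Above a' x) → Stack a b n → Stack a' b n
  stack-lowerˡ {n = zero}  _     _                     = tt
  stack-lowerˡ {n = suc n} lower (g , a<g , g<b , rest) = g , lower a<g , g<b , rest

  stack-raiseʳ : ∀ {a b b' n} → (∀ {x} → Below x b → Below x b') → Stack a b n → Stack a b' n
  stack-raiseʳ {n = zero}  _     _                     = tt
  stack-raiseʳ {n = suc n} raise (g , a<g , g<b , rest) = g , a<g , raise g<b , stack-raiseʳ raise rest

  stack-snoc : ∀ {a b x n} → Stack a (just x) n → (g : Copyω+ω*) →
               Above a (bottom g) → x < bottom g → Below (top g) b → Stack a b (suc n)
  stack-snoc {n = zero}  _                        g a<g _   g<b = g , a<g , g<b , tt
  stack-snoc {b = b} {n = suc n} (g₀ , a<g₀ , g₀<x , rest) g _ x<g g<b =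
    g₀ , a<g₀ , below-trans {b = b} (<-trans g₀<x (<-trans x<g (bottom<top g))) g<b ,
    stack-snoc rest g (<-trans g₀<x x<g) x<g g<b

  stack-split : ∀ {a b} m {n} (y : X) → Stack a b (m + n) → Stack a (just y) m ⊎ Stack (just y) b n
  stack-split zero    y _ = inj₁ tt
  stack-split (suc m) y (g , a<g , g<b , rest) with <-or-≥ (top g) y
  ... | inj₁ g<y = Sum.map₁ (λ below → g , a<g , g<y , below) (stack-split m y rest)
  ... | inj₂ y≤g = inj₂ (stack-lowerˡ (≤-<-trans y≤g) (stack-truncate (ℕ.m≤n+m _ m) rest))

  Unbounded : Maybe X → Maybe X → Set
  Unbounded a b = ∀ n → Stack a b n

  module _ (em : ExcludedMiddle 0ℓ) (dc : DependentChoice) where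

    private
      dne : {P : Set} → ¬ ¬ P → P
      dne = em⇒dne em

    unbounded-split : ∀ {a b} → Unbounded a b → (y : X) → Unbounded a (just y) ⊎ Unbounded (just y) b
    unbounded-split {a} u y with em {Unbounded a (just y)}
    ... | yes below = inj₁ below
    ... | no ¬below = let (m , ¬stack) = ¬∀⇒∃¬ em ¬below in
      inj₂ λ n → fromInj₂ (⊥-elim ∘ ¬stack) (stack-split m y (u (m + n)))

    Rung : Maybe X → Set
    Rung a = Σ Copyω+ω* λ g → Above a (bottom g) × Unbounded (just (top g)) nothing

    ascendingLadder : (∀ a → Unbounded a nothing → Rung a) → Unbounded nothing nothing → AscendingLadder
    ascendingLadder rung u = let (f , steps) = chooseSequence dc _ next first in proj₁ ∘ f , steps
      where
      Node : Set
      Node = Σ Copyω+ω* λ g → Unbounded (just (top g)) nothing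
      next : (s : Node) → ∃ λ (t : Node) → top (proj₁ s) < bottom (proj₁ t)
      next (g , u') = let (g' , g<g' , u'') = rung (just (top g)) u' in (g' , u'') , g<g'
      first : Node
      first = let (g , _ , u') = rung nothing u in g , u'

    descendingLadder : ∀ {a} → Unbounded a nothing → ¬ Rung a → DescendingLadder
    descendingLadder {a} u ¬rung = let (f , steps) = chooseSequence dc _ next first in proj₁ ∘ f , steps
      where
      -- of the two lowest copies of a stack, the upper one joins the ladder; unboundedly many copies
      -- remain below the lower one, since unboundedly many above it would make it a rung
      descend : ∀ {b} → Unbounded a b →
                Σ Copyω+ω* λ g → Below (top g) b × Σ X λ c → c < bottom g × Unbounded a (just c)
      descend u with u 2
      ... | g₁ , a<g₁ , _ , g₂ , g₁<g₂ , g₂<b , _ with unbounded-split u (top g₁)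
      ...   | inj₁ below = g₂ , g₂<b , top g₁ , g₁<g₂ , below
      ...   | inj₂ above = ⊥-elim (¬rung (g₁ , a<g₁ , λ n → stack-raiseʳ (λ _ → tt) (above n)))
      Node : Set
      Node = Σ Copyω+ω* λ g → Σ X λ c → c < bottom g × Unbounded a (just c)
      next : (s : Node) → ∃ λ (t : Node) → top (proj₁ t) < bottom (proj₁ s)
      next (g , c , c<g , u') = let (g' , g'<c , rest) = descend u' in (g' , rest) , <-trans g'<c c<g
      first : Node
      first = let (g , _ , rest) = descend u in g , rest

    unbounded⇒ladder : Unbounded nothing nothing → AscendingLadder ⊎ DescendingLadder
    unbounded⇒ladder u with em {Σ (Maybe X) λ a → Unbounded a nothing × ¬ Rung a}
    ... | yes (a , u' , ¬rung) = inj₂ (descendingLadder u' ¬rung)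
    ... | no ¬stuck = inj₁ (ascendingLadder (λ a u' → dne λ ¬rung → ¬stuck (a , u' , ¬rung)) u)

    boundedStacks⇒layering : ∀ {N} → ¬ Stack nothing nothing N → Layering N
    boundedStacks⇒layering {N} ¬stack = record
      { layer           = λ x → fromℕ< (height<N x)
      ; layer-monotone  = λ x y x<y → subst₂ ℕ._≤_ (sym (Fin.toℕ-fromℕ< _)) (sym (Fin.toℕ-fromℕ< _))
                                                   (height-monotone x<y)
      ; layer-separates = λ g eq → height-separates g
          (trans (sym (Fin.toℕ-fromℕ< _)) (trans (cong toℕ eq) (Fin.toℕ-fromℕ< _))) }
      where
      stack<N : ∀ {x j} → Stack nothing (just x) j → j ℕ.< N
      stack<N s = ℕ.≰⇒> λ N≤j → ¬stack (stack-raiseʳ (λ _ → tt) (stack-truncate N≤j s))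
      tallest : ∀ x → ∃ λ h → Stack nothing (just x) h ×
                                (∀ j → Stack nothing (just x) j → j ℕ.≤ h)
      tallest x = maximum (Stack nothing (just x)) (λ _ → em) tt N (λ _ → stack<N)
      height : X → ℕ
      height x = proj₁ (tallest x)
      height<N : ∀ x → height x ℕ.< N
      height<N x = stack<N (proj₁ (proj₂ (tallest x)))
      height-monotone : ∀ {x y} → x < y → height x ℕ.≤ height y
      height-monotone {x} {y} x<y = proj₂ (proj₂ (tallest y)) _
        (stack-raiseʳ (λ z<x → <-trans z<x x<y) (proj₁ (proj₂ (tallest x))))
      height-separates : ∀ g → height (bottom g) ≢ height (top g)
      height-separates g eq = ℕ.<-irrefl eq (proj₂ (proj₂ (tallest (top g))) _
        (stack-snoc (proj₁ (proj₂ (tallest (bottom g)))) (shift g) tt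
                    (asc-increasing g 0) (desc-decreasing g 0)))

    layering⊎ladder : ∃ Layering ⊎ (AscendingLadder ⊎ DescendingLadder)
    layering⊎ladder with em {∃ λ N → ¬ Stack nothing nothing N}
    ... | yes (N , ¬stack) = inj₁ (N , boundedStacks⇒layering ¬stack)
    ... | no unbounded = inj₂ (unbounded⇒ladder λ N → dne λ ¬stack → unbounded (N , ¬stack))

    module Halves {n} (L : Layering n) where
      open Layering L

      AscentBelow : X → Set
      AscentBelow x = Σ (ℕ → X) λ s →
        (∀ i → layer (s i) ≡ layer x) × (∀ i → s i < s (suc i)) × (∀ i → s i < x)

      side : X → Fin 2
      side x with em {AscentBelow x}
      ... | yes _ = 1F
      ... | no  _ = 0F

      side-spec : ∀ x → side x ≡ 1F × AscentBelow x ⊎ side x ≡ 0F × ¬ AscentBelow x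
      side-spec x with em {AscentBelow x}
      ... | yes ascent = inj₁ (refl , ascent)
      ... | no ¬ascent = inj₂ (refl , ¬ascent)

      side≡1⇒ascent : ∀ {x} → side x ≡ 1F → AscentBelow x
      side≡1⇒ascent {x} x₁ with side-spec x
      ... | inj₁ (_ , ascent) = ascent
      ... | inj₂ (x₀ , _) with () ← trans (sym x₁) x₀

      side≡0⇒¬ascent : ∀ {x} → side x ≡ 0F → ¬ AscentBelow x
      side≡0⇒¬ascent {x} x₀ with side-spec x
      ... | inj₁ (x₁ , _) with () ← trans (sym x₀) x₁
      ... | inj₂ (_ , ¬ascent) = ¬ascent

      side-monotone : ∀ {x y} → x < y → layer x ≡ layer y → side x Fin.≤ side y
      side-monotone {x} {y} x<y eq with side-spec x | side-spec y
      ... | inj₂ (x₀ , _) | _ = subst (Fin._≤ side y) (sym x₀) z≤n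
      ... | inj₁ (x₁ , _) | inj₁ (y₁ , _) = Fin.≤-reflexive (trans x₁ (sym y₁))
      ... | inj₁ (_ , s , same , inc , below) | inj₂ (_ , ¬ascent) =
        ⊥-elim (¬ascent (s , (λ i → trans (same i) eq) , inc , λ i → <-trans (below i) x<y))

      block : X → Fin (n ℕ.* 2)
      block x = combine (layer x) (side x)

      block-monotone : ∀ x y → x < y → block x Fin.≤ block y
      block-monotone x y x<y with ℕ.m≤n⇒m<n∨m≡n (layer-monotone x y x<y)
      ... | inj₁ lt = ℕ.<⇒≤ (Fin.combine-monoˡ-< (side x) (side y) lt)
      ... | inj₂ eq = subst (λ l → block x Fin.≤ combine l (side y)) (Fin.toℕ-injective eq)
                            (combine-monoʳ-≤ (layer x) (side-monotone x<y (Fin.toℕ-injective eq)))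

      block≡⇒layer≡ : ∀ {x} {l : Fin n} {s : Fin 2} → block x ≡ combine l s → layer x ≡ l
      block≡⇒layer≡ {x} {l} {s} = Fin.combine-injectiveˡ (layer x) (side x) l s

      block≡⇒side≡ : ∀ {x} {l : Fin n} {s : Fin 2} → block x ≡ combine l s → side x ≡ s
      block≡⇒side≡ {x} {l} {s} = Fin.combine-injectiveʳ (layer x) (side x) l s

      upperHalf : ∀ (l : Fin n) → Surordinal (sub ordered (λ x → block x ≡ combine l 1F))
      upperHalf l = noDescentAbove⇒surordinal ordered _ em dc <-trans λ x bx z bz x<z desc →
        let (s , same , inc , below) = side≡1⇒ascent (block≡⇒side≡ bx)
        in layer-separates
             (record { asc = s ; desc = z ; asc-increasing = inc ; desc-decreasing = desc
                     ; asc<desc = λ i j → <-trans (below i) (x<z j) })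
             (trans (same 0) (trans (block≡⇒layer≡ bx) (sym (block≡⇒layer≡ (bz 0)))))

      lowerHalf : ∀ (l : Fin n) → ReverseSurordinal (sub ordered (λ x → block x ≡ combine l 0F))
      lowerHalf l = noDescentAbove⇒surordinal (reverse ordered) _ em dc (λ p q → <-trans q p)
        λ y by z bz z<y asc → side≡0⇒¬ascent (block≡⇒side≡ by)
          (z , (λ i → trans (block≡⇒layer≡ (bz i)) (sym (block≡⇒layer≡ by))) , asc , z<y)

      Shaped : Fin (n ℕ.* 2) → Set
      Shaped i = let B = sub ordered (λ x → block x ≡ i) in Surordinal B ⊎ ReverseSurordinal B

      combine-shaped : ∀ (l : Fin n) (s : Fin 2) → Shaped (combine l s)
      combine-shaped l 0F = inj₂ (lowerHalf l)
      combine-shaped l 1F = inj₁ (upperHalf l)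

    layering⇒finiteSum : ∀ {n} → Layering n → FiniteSumOfSurordinals C
    layering⇒finiteSum {n} L =
      n ℕ.* 2 , block , block-monotone ,
      λ i → subst Shaped (Fin.combine-remQuot {n} 2 i) (combine-shaped _ _)
      where open Halves L

proposition3 : ExcludedMiddle 0ℓ → DependentChoice → (C : Chain) →
    ((¬ ([ω*+ω]·ω ↪ Chain.ordered C)) × (¬ ([ω*+ω]·ω* ↪ Chain.ordered C)))
    ⇔ FiniteSumOfSurordinals C
proposition3 em dc C = mk⇔ toFiniteSum fromFiniteSum
  where
  open OnChain C
  open Chain C using (ordered)
  toFiniteSum : (¬ ([ω*+ω]·ω ↪ ordered)) × (¬ ([ω*+ω]·ω* ↪ ordered)) → FiniteSumOfSurordinals C
  toFiniteSum (¬ω , ¬ω*) with layering⊎ladder em dc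
  ... | inj₁ (_ , L)           = layering⇒finiteSum em dc L
  ... | inj₂ (inj₁ ascending)  = ⊥-elim (¬ω (ascendingLadder⇒embedding ascending))
  ... | inj₂ (inj₂ descending) = ⊥-elim (¬ω* (descendingLadder⇒embedding descending))
  fromFiniteSum : FiniteSumOfSurordinals C → (¬ ([ω*+ω]·ω ↪ ordered)) × (¬ ([ω*+ω]·ω* ↪ ordered))
  fromFiniteSum sum with finiteSum⇒layering sum
  ... | _ , L = Layering.¬ascendingLadder L ∘ embedding⇒ascendingLadder ,
                Layering.¬descendingLadder L ∘ embedding⇒descendingLadder
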